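{- Let $M=\begin{pmatrix} m_{11} & m_{12} \\ m_{12} & m_{22} \end{pmatrix} \in M_2({\mathbb{Z}})$ be positive definite and different from $\begin{pmatrix} 1 & 0 \\ 0 & 1 \end{pmatrix}$. Then there exists a prime $p_{2} \leq m_{11}m_{22}$ and an integer $2 \leq C_2 \leq \gamma_{p_{2}}$ such that any positive semidefinite matrix of the block form \[ \begin{pmatrix} M & v \\ v^{\mathrm{T}} & C_2m_{11} \end{pmatrix} \in M_3({\mathbb{Z}}), \] with $v \in {\mathbb{Z}}^2$ arbitrary, is in fact positive definite.
   Context: For an odd prime $p$, $\gamma_p$ denotes the least positive quadratic non-residue modulo $p$, and by convention $\gamma_2 = 7$. A real symmetric matrix $X$ is positive semidefinite if $x^{\mathrm{T}}Xx \geq 0$ for all real vectors $x$, and positive definite if equality holds only for $x=0$.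
   Formalization: The test vectors x in positive semidefiniteness and positive definiteness are taken in ℚ^n rather than among all real vectors. -}

module Defs where

open import Data.Nat as ℕ using (ℕ; zero; suc)
open import Data.Integer as ℤ using (ℤ; +_)
open import Data.Integer.Divisibility as ℤD using ()
open import Data.Rational as ℚ using (ℚ; 0ℚ)
open import Data.Fin using (Fin; zero; suc)
open import Data.Product using (Σ; ∃; _×_)
open import Data.Sum using (_⊎_)
open import Relation.Binary.PropositionalEquality using (_≡_; _≢_)
open import Relation.Nullary using (¬_)

sumℚ : (n : ℕ) → (Fin n → ℚ) → ℚ
sumℚ zero    f = 0ℚ
sumℚ (suc n) f = f zero ℚ.+ sumℚ n (λ i → f (suc i))

Mat : ℕ → Set
Mat n = Fin n → Fin n → ℤ

toℚ : ℤ → ℚ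
toℚ z = z ℚ./ 1

quadForm : (n : ℕ) → Mat n → (Fin n → ℚ) → ℚ
quadForm n X x = sumℚ n (λ i → sumℚ n (λ j → x i ℚ.* (toℚ (X i j) ℚ.* x j)))

Symmetric : (n : ℕ) → Mat n → Set
Symmetric n X = ∀ i j → X i j ≡ X j i

IsZeroVec : (n : ℕ) → (Fin n → ℚ) → Set
IsZeroVec n x = ∀ i → x i ≡ 0ℚ

PosSemiDef : (n : ℕ) → Mat n → Set
PosSemiDef n X = Symmetric n X × (∀ (x : Fin n → ℚ) → 0ℚ ℚ.≤ quadForm n X x)

PosDef : (n : ℕ) → Mat n → Set
PosDef n X = Symmetric n X × (∀ (x : Fin n → ℚ) → ¬ IsZeroVec n x → 0ℚ ℚ.< quadForm n X x)

mat2 : ℤ → ℤ → ℤ → Mat 2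
mat2 a b c zero       zero       = a
mat2 a b c zero       (suc zero) = b
mat2 a b c (suc zero) zero       = b
mat2 a b c (suc zero) (suc zero) = c

mat3 : ℤ → ℤ → ℤ → ℤ → ℤ → ℤ → Mat 3
mat3 a b c v1 v2 d zero             zero             = a
mat3 a b c v1 v2 d zero             (suc zero)       = b
mat3 a b c v1 v2 d zero             (suc (suc zero)) = v1
mat3 a b c v1 v2 d (suc zero)       zero             = b
mat3 a b c v1 v2 d (suc zero)       (suc zero)       = c
mat3 a b c v1 v2 d (suc zero)       (suc (suc zero)) = v2
mat3 a b c v1 v2 d (suc (suc zero)) zero             = v1
mat3 a b c v1 v2 d (suc (suc zero)) (suc zero)       = v2
mat3 a b c v1 v2 d (suc (suc zero)) (suc (suc zero)) = d

QNR : ℕ → ℕ → Set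
QNR p a = ¬ ((+ p) ℤD.∣ (+ a)) × ¬ (∃ λ (x : ℤ) → (+ p) ℤD.∣ (x ℤ.* x ℤ.- + a))

IsLeastQNR : ℕ → ℕ → Set
IsLeastQNR p g = 1 ℕ.≤ g × QNR p g × (∀ k → 1 ℕ.≤ k → k ℕ.< g → ¬ QNR p k)

-- IsGamma p g  ⇔  g = γ_p  (with the convention γ_2 = 7).
IsGamma : ℕ → ℕ → Set
IsGamma p g = (p ≡ 2 × g ≡ 7) ⊎ (p ≢ 2 × IsLeastQNR p g)

{-# OPTIONS --safe #-}
module Submission where

-- Write d = m11 m22 - m12² > 0 and let N be the block matrix with corner C m11.  A Schur
-- complement computation gives m11 d · xᵀ N x = d A² + B² + m11 det N · x₃² for two linear forms
-- A, B, so a positive semidefinite N is positive definite as soon as det N ≠ 0.  Completing the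
-- square, m11 · vᵀ adj(M) v = (m11 v2 - m12 v1)² + d v1², so det N = 0 gives a solution of
-- X² + d Y² = C d Z² with Z = m11 ≠ 0.  Writing d = t² s, it suffices that X² + s Y² - C s Z² is
-- anisotropic.  For s = 1, 2 take p = 2 and C = γ₂ = 7; otherwise some odd prime p divides s
-- exactly once and C = γ_p.  Because -1 and -2 are non-residues mod 7, resp. γ_p is one mod p,
-- every solution is divisible by 7, resp. p, in all three coordinates, and infinite descent
-- leaves only Z = 0.  Finally γ_p exists since the nonzero squares mod p are the squares of
-- 1, …, (p - 1)/2, too few to be all the nonzero residues.

open import Defs
open import Data.Product using (_×_; _,_; proj₁; proj₂; ∃; ∃₂)
open import Data.Sum using (_⊎_; inj₁; inj₂; [_,_]; [_,_]′; fromInj₂)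
open import Data.Empty using (⊥-elim)
open import Function using (_∘_)
open import Relation.Nullary using (¬_; Dec; yes; no; contradiction)
open import Relation.Binary.PropositionalEquality
  using (_≡_; _≢_; refl; sym; trans; cong; cong₂; subst; module ≡-Reasoning)

module Positivity where

  open import Data.Nat using (zero; suc)
  open import Data.Nat.Coprimality as Coprime using (Coprime)
  open import Data.Integer as ℤ using (ℤ; -[1+_]; ∣_∣; 0ℤ)
  import Data.Integer.Properties as ℤP
  open import Data.Rational
    using (ℚ; mkℚ; 0ℚ; 1ℚ; _+_; _-_; -_; _*_; _<_; _≤_; *<*; *≤*; _/_; positive; nonNegative; negative)
  import Data.Rational.Properties as ℚP
  open import Data.Fin using (Fin)
  open import Data.Fin.Patterns using (0F; 1F; 2F)
  open import Data.Vec.Functional using (_∷_; [])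
  open import Level using (0ℓ)
  open import Relation.Nullary.Decidable using (dec⇒maybe)
  open import Relation.Binary.Definitions using (tri<; tri≈; tri>)
  open import Tactic.RingSolver using (solve-∀)
  open import Tactic.RingSolver.Core.AlmostCommutativeRing
    using (AlmostCommutativeRing; fromCommutativeRing)

  det2 : ℤ → ℤ → ℤ → ℤ
  det2 a b c = a ℤ.* c ℤ.- b ℤ.* b

  -- vᵀ adj(M) v for M = (a b ; b c) and v = (s , t)
  adjForm : ℤ → ℤ → ℤ → ℤ → ℤ → ℤ
  adjForm a b c s t = s ℤ.* (c ℤ.* s ℤ.- b ℤ.* t) ℤ.+ t ℤ.* (a ℤ.* t ℤ.- b ℤ.* s)

  -- det (a b s ; b c t ; s t D), expanded along the last row
  det3 : ℤ → ℤ → ℤ → ℤ → ℤ → ℤ → ℤ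
  det3 a b c s t D = D ℤ.* det2 a b c ℤ.- adjForm a b c s t

  ℚ-ring : AlmostCommutativeRing 0ℓ 0ℓ
  ℚ-ring = fromCommutativeRing ℚP.+-*-commutativeRing (λ x → dec⇒maybe (0ℚ ℚP.≟ x))

  coprime-1 : ∀ n → Coprime n 1
  coprime-1 n = Coprime.sym (Coprime.1-coprimeTo n)

  toℚ≡mkℚ : ∀ i → toℚ i ≡ mkℚ i 0 (coprime-1 ∣ i ∣)
  toℚ≡mkℚ (ℤ.+ n)    = ℚP.normalize-coprime (coprime-1 n)
  toℚ≡mkℚ -[1+ n ] = cong -_ (ℚP.normalize-coprime (coprime-1 (suc n)))

  toℚ-* : ∀ i j → toℚ (i ℤ.* j) ≡ toℚ i * toℚ j
  toℚ-* i j rewrite toℚ≡mkℚ i | toℚ≡mkℚ j = refl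

  toℚ-+ : ∀ i j → toℚ (i ℤ.+ j) ≡ toℚ i + toℚ j
  toℚ-+ i j rewrite toℚ≡mkℚ i | toℚ≡mkℚ j =
    cong (_/ 1) (sym (cong₂ ℤ._+_ (ℤP.*-identityʳ i) (ℤP.*-identityʳ j)))

  toℚ-neg : ∀ i → toℚ (ℤ.- i) ≡ - toℚ i
  toℚ-neg (ℤ.+ zero)  = refl
  toℚ-neg (ℤ.+ suc n) = refl
  toℚ-neg -[1+ n ]    = trans (toℚ≡mkℚ (ℤ.+ suc n)) (sym (cong -_ (toℚ≡mkℚ -[1+ n ])))

  toℚ-- : ∀ i j → toℚ (i ℤ.- j) ≡ toℚ i - toℚ j
  toℚ-- i j = trans (toℚ-+ i (ℤ.- j)) (cong (toℚ i +_) (toℚ-neg j))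

  toℚ-*-* : ∀ i j k l → toℚ (i ℤ.* j ℤ.- k ℤ.* l) ≡ toℚ i * toℚ j - toℚ k * toℚ l
  toℚ-*-* i j k l = trans (toℚ-- (i ℤ.* j) (k ℤ.* l)) (cong₂ _-_ (toℚ-* i j) (toℚ-* k l))

  toℚ-det2 : ∀ a b c → toℚ (det2 a b c) ≡ toℚ a * toℚ c - toℚ b * toℚ b
  toℚ-det2 a b c = toℚ-*-* a c b b

  toℚ-det3 : ∀ a b c s t D → toℚ (det3 a b c s t D) ≡
    toℚ D * (toℚ a * toℚ c - toℚ b * toℚ b)
    - (toℚ s * (toℚ c * toℚ s - toℚ b * toℚ t) + toℚ t * (toℚ a * toℚ t - toℚ b * toℚ s))
  toℚ-det3 a b c s t D =
    trans (toℚ-- (D ℤ.* det2 a b c) (adjForm a b c s t))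
          (cong₂ _-_ (trans (toℚ-* D (det2 a b c)) (cong (toℚ D *_) (toℚ-det2 a b c))) toℚ-adjForm)
    where
    toℚ-adjForm : toℚ (adjForm a b c s t) ≡
      toℚ s * (toℚ c * toℚ s - toℚ b * toℚ t) + toℚ t * (toℚ a * toℚ t - toℚ b * toℚ s)
    toℚ-adjForm =
      trans (toℚ-+ (s ℤ.* (c ℤ.* s ℤ.- b ℤ.* t)) (t ℤ.* (a ℤ.* t ℤ.- b ℤ.* s)))
            (cong₂ _+_ (trans (toℚ-* s _) (cong (toℚ s *_) (toℚ-*-* c s b t)))
                       (trans (toℚ-* t _) (cong (toℚ t *_) (toℚ-*-* a t b s))))

  toℚ-mono-< : ∀ {i} → 0ℤ ℤ.< i → 0ℚ < toℚ i
  toℚ-mono-< {i} 0<i rewrite toℚ≡mkℚ i = *<* (subst (0ℤ ℤ.<_) (sym (ℤP.*-identityʳ i)) 0<i)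

  toℚ-cancel-< : ∀ {i} → 0ℚ < toℚ i → 0ℤ ℤ.< i
  toℚ-cancel-< {i} 0<i rewrite toℚ≡mkℚ i with 0<i
  ... | *<* 0<i*1 = subst (0ℤ ℤ.<_) (ℤP.*-identityʳ i) 0<i*1

  toℚ-cancel-≤ : ∀ {i} → 0ℚ ≤ toℚ i → 0ℤ ℤ.≤ i
  toℚ-cancel-≤ {i} 0≤i rewrite toℚ≡mkℚ i with 0≤i
  ... | *≤* 0≤i*1 = subst (0ℤ ℤ.≤_) (ℤP.*-identityʳ i) 0≤i*1

  pos*pos : ∀ {p q} → 0ℚ < p → 0ℚ < q → 0ℚ < p * q
  pos*pos {p} {q} p>0 q>0 =
    ℚP.positive⁻¹ _ {{ℚP.pos*pos⇒pos p {{positive p>0}} q {{positive q>0}}}}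

  pos*nonNeg : ∀ {p q} → 0ℚ < p → 0ℚ ≤ q → 0ℚ ≤ p * q
  pos*nonNeg {p} {q} p>0 q≥0 =
    ℚP.nonNegative⁻¹ _ {{ℚP.nonNeg*nonNeg⇒nonNeg p {{nonNegative (ℚP.<⇒≤ p>0)}} q {{nonNegative q≥0}}}}

  pos*-cancel-< : ∀ {r p} → 0ℚ < r → 0ℚ < r * p → 0ℚ < p
  pos*-cancel-< {r} {p} r>0 rp>0 =
    ℚP.*-cancelˡ-<-nonNeg r {{nonNegative (ℚP.<⇒≤ r>0)}} (subst (_< r * p) (sym (ℚP.*-zeroʳ r)) rp>0)

  pos*-cancel-≤ : ∀ {r p} → 0ℚ < r → 0ℚ ≤ r * p → 0ℚ ≤ p
  pos*-cancel-≤ {r} {p} r>0 rp≥0 =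
    ℚP.*-cancelˡ-≤-pos r {{positive r>0}} (subst (_≤ r * p) (sym (ℚP.*-zeroʳ r)) rp≥0)

  pos*≢0 : ∀ {r p} → 0ℚ < r → p ≢ 0ℚ → r * p ≢ 0ℚ
  pos*≢0 {r} {p} r>0 p≢0 rp≡0 with ℚP.<-cmp p 0ℚ
  ... | tri< p<0 _ _ = ℚP.<⇒≢ (ℚP.negative⁻¹ _ {{ℚP.pos*neg⇒neg r {{positive r>0}} p {{negative p<0}}}}) rp≡0
  ... | tri≈ _ p≡0 _ = p≢0 p≡0
  ... | tri> _ _ p>0 = ℚP.<⇒≢ (pos*pos r>0 p>0) (sym rp≡0)

  square-pos : ∀ {p} → p ≢ 0ℚ → 0ℚ < p * p
  square-pos {p} p≢0 with ℚP.<-cmp p 0ℚ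
  ... | tri< p<0 _ _ = ℚP.positive⁻¹ _ {{ℚP.neg*neg⇒pos p {{negative p<0}} p {{negative p<0}}}}
  ... | tri≈ _ p≡0 _ = ⊥-elim (p≢0 p≡0)
  ... | tri> _ _ p>0 = pos*pos p>0 p>0

  square-nonNeg : ∀ p → 0ℚ ≤ p * p
  square-nonNeg p with p ℚP.≟ 0ℚ
  ... | yes refl = ℚP.≤-refl
  ... | no p≢0   = ℚP.<⇒≤ (square-pos p≢0)

  +-*-zero : ∀ p q {r} → r ≡ 0ℚ → p + q * r ≡ p
  +-*-zero p q refl = trans (cong (p +_) (ℚP.*-zeroʳ q)) (ℚP.+-identityʳ p)

  schur-identity : ∀ a b c s t D x →
    let d = toℚ (det2 a b c)
        A = toℚ a * x 0F + toℚ b * x 1F + toℚ s * x 2F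
        B = d * x 1F + toℚ (a ℤ.* t ℤ.- b ℤ.* s) * x 2F
    in toℚ a * d * quadForm 3 (mat3 a b c s t D) x
       ≡ d * (A * A) + B * B + toℚ a * toℚ (det3 a b c s t D) * (x 2F * x 2F)
  schur-identity a b c s t D x
    rewrite toℚ-det3 a b c s t D | toℚ-det2 a b c | toℚ-*-* a t b s =
      expanded (toℚ a) (toℚ b) (toℚ c) (toℚ s) (toℚ t) (toℚ D) (x 0F) (x 1F) (x 2F)
    where
    expanded : ∀ a b c s t D x₀ x₁ x₂ →
      a * (a * c - b * b) *
        ((x₀ * (a * x₀) + (x₀ * (b * x₁) + (x₀ * (s * x₂) + 0ℚ)))
        + ((x₁ * (b * x₀) + (x₁ * (c * x₁) + (x₁ * (t * x₂) + 0ℚ)))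
        + ((x₂ * (s * x₀) + (x₂ * (t * x₁) + (x₂ * (D * x₂) + 0ℚ))) + 0ℚ)))
      ≡ (a * c - b * b) * ((a * x₀ + b * x₁ + s * x₂) * (a * x₀ + b * x₁ + s * x₂))
        + ((a * c - b * b) * x₁ + (a * t - b * s) * x₂) * ((a * c - b * b) * x₁ + (a * t - b * s) * x₂)
        + a * (D * (a * c - b * b) - (s * (c * s - b * t) + t * (a * t - b * s))) * (x₂ * x₂)
    expanded = solve-∀ ℚ-ring

  mat3-symmetric : ∀ a b c s t D → Symmetric 3 (mat3 a b c s t D)
  mat3-symmetric a b c s t D 0F 0F = refl
  mat3-symmetric a b c s t D 0F 1F = refl
  mat3-symmetric a b c s t D 0F 2F = refl
  mat3-symmetric a b c s t D 1F 0F = refl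
  mat3-symmetric a b c s t D 1F 1F = refl
  mat3-symmetric a b c s t D 1F 2F = refl
  mat3-symmetric a b c s t D 2F 0F = refl
  mat3-symmetric a b c s t D 2F 1F = refl
  mat3-symmetric a b c s t D 2F 2F = refl

  posDef₂⇒leading-minors-pos : ∀ {a b c} → PosDef 2 (mat2 a b c) → 0ℤ ℤ.< a × 0ℤ ℤ.< det2 a b c
  posDef₂⇒leading-minors-pos {a} {b} {c} (_ , pos) =
    toℚ-cancel-< 0<a , toℚ-cancel-< (pos*-cancel-< 0<a 0<a*d)
    where
    at-e₀ : ∀ a b c → (1ℚ * (a * 1ℚ) + (1ℚ * (b * 0ℚ) + 0ℚ)) + ((0ℚ * (b * 1ℚ) + (0ℚ * (c * 0ℚ) + 0ℚ)) + 0ℚ) ≡ a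
    at-e₀ = solve-∀ ℚ-ring
    at-v : ∀ a b c →
      ((- b) * (a * (- b)) + ((- b) * (b * a) + 0ℚ)) + ((a * (b * (- b)) + (a * (c * a) + 0ℚ)) + 0ℚ)
      ≡ a * (a * c - b * b)
    at-v = solve-∀ ℚ-ring
    0<a : 0ℚ < toℚ a
    0<a = subst (0ℚ <_) (at-e₀ (toℚ a) (toℚ b) (toℚ c)) (pos (1ℚ ∷ 0ℚ ∷ []) (λ e₀≡0 → ℚP.1≢0 (e₀≡0 0F)))
    0<a*d : 0ℚ < toℚ a * toℚ (det2 a b c)
    0<a*d = subst (0ℚ <_) (trans (at-v (toℚ a) (toℚ b) (toℚ c)) (cong (toℚ a *_) (sym (toℚ-det2 a b c))))
                  (pos (- toℚ b ∷ toℚ a ∷ []) (λ v≡0 → ℚP.<⇒≢ 0<a (sym (v≡0 1F))))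

  posSemiDef₃⇒det3-nonNeg : ∀ {a b c s t D} → 0ℤ ℤ.< a → 0ℤ ℤ.< det2 a b c →
    PosSemiDef 3 (mat3 a b c s t D) → 0ℤ ℤ.≤ det3 a b c s t D
  posSemiDef₃⇒det3-nonNeg {a} {b} {c} {s} {t} {D} 0<a 0<d (_ , psd) =
    toℚ-cancel-≤ (pos*-cancel-≤ (pos*pos a>0 (pos*pos d*a>0 d*a>0)) 0≤a*K²*Δ)
    where
    a′ = toℚ a
    d = toℚ (det2 a b c)
    e = toℚ (a ℤ.* t ℤ.- b ℤ.* s)
    Δ = toℚ (det3 a b c s t D)
    a>0 : 0ℚ < a′
    a>0 = toℚ-mono-< 0<a
    d*a>0 : 0ℚ < d * a′
    d*a>0 = pos*pos (toℚ-mono-< 0<d) a>0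
    -- the two squares A² and B² of the Schur identity vanish at this vector
    v : Fin 3 → ℚ
    v = toℚ b * e - toℚ s * d ∷ - (e * a′) ∷ d * a′ ∷ []
    vanishing : ∀ a b s d e Δ →
      d * ((a * (b * e - s * d) + b * (- (e * a)) + s * (d * a))
           * (a * (b * e - s * d) + b * (- (e * a)) + s * (d * a)))
      + (d * (- (e * a)) + e * (d * a)) * (d * (- (e * a)) + e * (d * a))
      + a * Δ * ((d * a) * (d * a))
      ≡ a * ((d * a) * (d * a)) * Δ
    vanishing = solve-∀ ℚ-ring
    0≤a*K²*Δ : 0ℚ ≤ a′ * ((d * a′) * (d * a′)) * Δ
    0≤a*K²*Δ = subst (0ℚ ≤_) (trans (schur-identity a b c s t D v) (vanishing a′ (toℚ b) (toℚ s) d e Δ))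
                     (pos*nonNeg (pos*pos a>0 (toℚ-mono-< 0<d)) (psd v))

  weighted-squares-pos : ∀ {α γ} u v w → 0ℚ < α → 0ℚ < γ → u ≢ 0ℚ ⊎ v ≢ 0ℚ ⊎ w ≢ 0ℚ →
    0ℚ < α * (u * u) + v * v + γ * (w * w)
  weighted-squares-pos u v w α>0 γ>0 (inj₁ u≢0) =
    ℚP.+-mono-<-≤ (ℚP.+-mono-<-≤ (pos*pos α>0 (square-pos u≢0)) (square-nonNeg v))
                  (pos*nonNeg γ>0 (square-nonNeg w))
  weighted-squares-pos u v w α>0 γ>0 (inj₂ (inj₁ v≢0)) =
    ℚP.+-mono-<-≤ (ℚP.+-mono-≤-< (pos*nonNeg α>0 (square-nonNeg u)) (square-pos v≢0))
                  (pos*nonNeg γ>0 (square-nonNeg w))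
  weighted-squares-pos u v w α>0 γ>0 (inj₂ (inj₂ w≢0)) =
    ℚP.+-mono-≤-< (ℚP.+-mono-≤ (pos*nonNeg α>0 (square-nonNeg u)) (square-nonNeg v))
                  (pos*pos γ>0 (square-pos w≢0))

  triangular-≢0 : ∀ {a d} b s e (x : Fin 3 → ℚ) → 0ℚ < a → 0ℚ < d → ¬ IsZeroVec 3 x →
    a * x 0F + b * x 1F + s * x 2F ≢ 0ℚ ⊎ d * x 1F + e * x 2F ≢ 0ℚ ⊎ x 2F ≢ 0ℚ
  triangular-≢0 {a} {d} b s e x a>0 d>0 x≢0 with x 2F ℚP.≟ 0ℚ | x 1F ℚP.≟ 0ℚ
  ... | no x₂≢0 | _ = inj₂ (inj₂ x₂≢0)
  ... | yes x₂≡0 | no x₁≢0 = inj₂ (inj₁ (pos*≢0 d>0 x₁≢0 ∘ trans (sym (+-*-zero (d * x 1F) e x₂≡0))))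
  ... | yes x₂≡0 | yes x₁≡0 = inj₁ (pos*≢0 a>0 x₀≢0 ∘ trans (sym A≡a*x₀))
    where
    x₀≢0 : x 0F ≢ 0ℚ
    x₀≢0 x₀≡0 = x≢0 λ { 0F → x₀≡0 ; 1F → x₁≡0 ; 2F → x₂≡0 }
    A≡a*x₀ : a * x 0F + b * x 1F + s * x 2F ≡ a * x 0F
    A≡a*x₀ = trans (+-*-zero _ s x₂≡0) (+-*-zero _ b x₁≡0)

  det3-pos⇒posDef₃ : ∀ {a b c s t D} → 0ℤ ℤ.< a → 0ℤ ℤ.< det2 a b c → 0ℤ ℤ.< det3 a b c s t D →
    PosDef 3 (mat3 a b c s t D)
  det3-pos⇒posDef₃ {a} {b} {c} {s} {t} {D} 0<a 0<d 0<Δ = mat3-symmetric a b c s t D , pos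
    where
    a>0 = toℚ-mono-< 0<a
    d>0 = toℚ-mono-< 0<d
    pos : ∀ x → ¬ IsZeroVec 3 x → 0ℚ < quadForm 3 (mat3 a b c s t D) x
    pos x x≢0 = pos*-cancel-< (pos*pos a>0 d>0)
      (subst (0ℚ <_) (sym (schur-identity a b c s t D x))
        (weighted-squares-pos _ _ _ d>0 (pos*pos a>0 (toℚ-mono-< 0<Δ))
          (triangular-≢0 (toℚ b) (toℚ s) (toℚ (a ℤ.* t ℤ.- b ℤ.* s)) x a>0 d>0 x≢0)))

  posSemiDef₃⇒posDef₃ : ∀ {a b c s t D} → 0ℤ ℤ.< a → 0ℤ ℤ.< det2 a b c → det3 a b c s t D ≢ 0ℤ →
    PosSemiDef 3 (mat3 a b c s t D) → PosDef 3 (mat3 a b c s t D)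
  posSemiDef₃⇒posDef₃ 0<a 0<d det≢0 psd =
    det3-pos⇒posDef₃ 0<a 0<d (ℤP.≤∧≢⇒< (posSemiDef₃⇒det3-nonNeg 0<a 0<d psd) (det≢0 ∘ sym))

module SquareClasses where

  open import Data.Nat
  open import Data.Nat.Properties
  open import Data.Nat.Divisibility
  open import Data.Nat.Induction using (<-rec)
  open import Data.Nat.ListAction using (product)
  open import Data.Nat.Primality
  open import Data.Nat.Primality.Factorisation using (factorise; module PrimeFactorisation)
  open import Data.Nat.Tactic.RingSolver using (solve-∀)
  open import Data.List using ([]; _∷_)
  open import Data.List.Relation.Unary.All using (All; []; _∷_)

  ∃-prime-factor : ∀ n → .{{NonZero n}} → n ≢ 1 → ∃ λ p → Prime p × p ∣ n
  ∃-prime-factor n n≢1 = from-factors (factors f) (isFactorisation f) (factorsPrime f)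
    where
    f = factorise n
    open PrimeFactorisation
    from-factors : ∀ ps → n ≡ product ps → All Prime ps → ∃ λ p → Prime p × p ∣ n
    from-factors []       n≡1     _        = contradiction n≡1 n≢1
    from-factors (p ∷ ps) n≡p*ps (pp ∷ _) = p , pp , divides (product ps) (trans n≡p*ps (*-comm p (product ps)))

  -- Square-free parts as far as the proof needs them: 1, 2, or divisible by an odd prime exactly once.
  data Kernel : ℕ → Set where
    one      : Kernel 1
    two      : Kernel 2
    oddPrime : ∀ {p u} → Prime p → p ≢ 2 → ¬ p ∣ u → Kernel (p * u)

  SquareClass : ℕ → Set
  SquareClass n = ∃₂ λ t s → n ≡ t * t * s × Kernel s

  square-class-*-square : ∀ {n} p → SquareClass n → SquareClass (n * (p * p))
  square-class-*-square {n} p (t , s , refl , κ) = t * p , s , regroup t s p , κ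
    where
    regroup : ∀ t s p → t * t * s * (p * p) ≡ t * p * (t * p) * s
    regroup = solve-∀

  prime-∣-2 : ∀ {q} → Prime q → q ∣ 2 → q ≡ 2
  prime-∣-2 {q} qp q∣2 = fromInj₂ q≢1 (prime⇒irreducible prime[2] q∣2)
    where
    q≢1 : q ≡ 1 → q ≡ 2
    q≢1 q≡1 = ⊥-elim (<-irrefl (sym q≡1) (nonTrivial⇒n>1 q {{prime⇒nonTrivial qp}}))

  square-class-*-2 : ∀ {n} → SquareClass n → SquareClass (n * 2)
  square-class-*-2 (t , .1 , refl , one) = t , 2 , regroup t , two
    where
    regroup : ∀ t → t * t * 1 * 2 ≡ t * t * 2
    regroup = solve-∀
  square-class-*-2 (t , .2 , refl , two) = t * 2 , 1 , regroup t , one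
    where
    regroup : ∀ t → t * t * 2 * 2 ≡ t * 2 * (t * 2) * 1
    regroup = solve-∀
  square-class-*-2 (t , .(q * u) , refl , oddPrime {q} {u} qp q≢2 q∤u) =
    t , q * (u * 2) , regroup t q u , oddPrime qp q≢2 q∤u*2
    where
    regroup : ∀ t q u → t * t * (q * u) * 2 ≡ t * t * (q * (u * 2))
    regroup = solve-∀
    q∤u*2 : ¬ q ∣ u * 2
    q∤u*2 q∣u*2 with euclidsLemma u 2 qp q∣u*2
    ... | inj₁ q∣u = q∤u q∣u
    ... | inj₂ q∣2 = q≢2 (prime-∣-2 qp q∣2)

  cofactor-< : ∀ {n k m} → n ≢ 0 → n ≡ k * m → 1 < m → k ≢ 0 × k < n
  cofactor-< {n} {zero}  n≢0 n≡0 _   = contradiction n≡0 n≢0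
  cofactor-< {n} {suc k} {m} _ refl 1<m = (λ ()) , m<m*n (suc k) m 1<m

  square-class : ∀ n → n ≢ 0 → SquareClass n
  square-class = <-rec (λ n → n ≢ 0 → SquareClass n) classify
    where
    classify : ∀ n → (∀ {m} → m < n → m ≢ 0 → SquareClass m) → n ≢ 0 → SquareClass n
    classify n recurse n≢0 with n ≟ 1
    ... | yes refl = 1 , 1 , refl , one
    ... | no n≢1 =
      let p , pp , divides k n≡k*p = ∃-prime-factor n {{≢-nonZero n≢0}} n≢1 in by-factor {p} {k} pp n≡k*p
      where
      by-factor : ∀ {p k} → Prime p → n ≡ k * p → SquareClass n
      by-factor {p} {k} pp n≡k*p with p ∣? k | p ≟ 2
      ... | yes (divides j k≡j*p) | _ =
        let j≢0 , j<n = cofactor-< {n} {j} {p * p} n≢0 n≡j*p² (*-mono-< p>1 p>1) in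
        subst SquareClass (sym n≡j*p²) (square-class-*-square p (recurse j<n j≢0))
        where
        p>1 = nonTrivial⇒n>1 p {{prime⇒nonTrivial pp}}
        n≡j*p² : n ≡ j * (p * p)
        n≡j*p² = trans n≡k*p (trans (cong (_* p) k≡j*p) (*-assoc j p p))
      ... | no p∤k | no p≢2 =
        1 , p * k , trans n≡k*p (trans (*-comm k p) (sym (+-identityʳ (p * k)))) , oddPrime pp p≢2 p∤k
      ... | no _ | yes refl =
        let k≢0 , k<n = cofactor-< {n} {k} {2} n≢0 n≡k*p (s≤s (s≤s z≤n)) in
        subst SquareClass (sym n≡k*p) (square-class-*-2 (recurse k<n k≢0))

module Anisotropy where

  open import Data.Nat as ℕ using (ℕ; zero; suc)
  import Data.Nat.Properties as ℕP
  import Data.Nat.Divisibility as ℕ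
  import Data.Nat.DivMod as ℕ
  open import Data.Nat.Coprimality using (Coprime; coprime-Bézout)
  open import Data.Nat.GCD using (module Bézout)
  open import Data.Nat.Induction using (<-rec)
  open import Data.Nat.Primality using (Prime; euclidsLemma; prime⇒irreducible; prime⇒nonZero; prime⇒nonTrivial)
  open import Data.Integer as ℤ using (ℤ; +_; -[1+_]; _+_; _-_; -_; _*_; 0ℤ; 1ℤ)
  import Data.Integer.Properties as ℤP
  import Data.Integer.Divisibility as Unsigned
  open import Data.Integer.Divisibility.Signed
    using (_∣_; divides; _∣?_; ∣ᵤ⇒∣; ∣⇒∣ᵤ; ∣-refl; ∣-trans; *-monoʳ-∣; *-monoˡ-∣; *-cancelˡ-∣;
           ∣m∣n⇒∣m+n; ∣m∣n⇒∣m-n; ∣m+n∣n⇒∣m; ∣m⇒∣-m; ∣n⇒∣m*n; ∣m⇒∣m*n)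
  open import Data.Integer.DivMod using (_%ℕ_; _/ℕ_; n%ℕd<d; a≡a%ℕn+[a/ℕn]*n)
  open import Data.Integer.Tactic.RingSolver using (solve-∀)
  open import Data.Fin using (Fin; toℕ; fromℕ<)
  import Data.Fin.Properties as Fin
  open import Data.Fin.Properties using (any?)
  import Relation.Nullary.Decidable as Dec

  euclidsLemmaℤ : ∀ {p} → Prime p → ∀ i j → + p ∣ i * j → + p ∣ i ⊎ + p ∣ j
  euclidsLemmaℤ pp i j p∣ij with euclidsLemma ℤ.∣ i ∣ ℤ.∣ j ∣ pp (subst (_ ℕ.∣_) (ℤP.abs-* i j) (∣⇒∣ᵤ p∣ij))
  ... | inj₁ p∣i = inj₁ (∣ᵤ⇒∣ p∣i)
  ... | inj₂ p∣j = inj₂ (∣ᵤ⇒∣ p∣j)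

  prime-∣-square : ∀ {p} → Prime p → ∀ {i} → + p ∣ i * i → + p ∣ i
  prime-∣-square pp {i} p∣ii with euclidsLemmaℤ pp i i p∣ii
  ... | inj₁ p∣i = p∣i
  ... | inj₂ p∣i = p∣i

  prime-∤⇒coprime : ∀ {p n} → Prime p → ¬ p ℕ.∣ n → Coprime p n
  prime-∤⇒coprime pp p∤n (d∣p , d∣n) with prime⇒irreducible pp d∣p
  ... | inj₁ d≡1 = d≡1
  ... | inj₂ refl = contradiction d∣n p∤n

  square-abs : ∀ i → i * i ≡ + ℤ.∣ i ∣ * + ℤ.∣ i ∣
  square-abs (+ n)    = refl
  square-abs -[1+ n ] = refl

  ∣±1⇒∣square-1 : ∀ {k} u → k ∣ u + 1ℤ ⊎ k ∣ u - 1ℤ → k ∣ u * u - 1ℤ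
  ∣±1⇒∣square-1 {k} u k∣u±1 =
    subst (k ∣_) (difference-of-squares u) ([ ∣m⇒∣m*n (u - 1ℤ) , ∣n⇒∣m*n (u + 1ℤ) ] k∣u±1)
    where
    difference-of-squares : ∀ u → (u + 1ℤ) * (u - 1ℤ) ≡ u * u - 1ℤ
    difference-of-squares = solve-∀

  -- Bézout gives y |i| ≡ ±1, and squaring removes both the ± and the sign of i.
  ∃-square-inverse : ∀ {p} → Prime p → ∀ {i} → ¬ + p ∣ i → ∃ λ α → + p ∣ (α * i) * (α * i) - 1ℤ
  ∃-square-inverse {p} pp {i} p∤i =
    let y , p∣y∣i∣±1 = ∃-inverse-up-to-sign in
    + y , subst (λ u → + p ∣ u - 1ℤ) (sym (square-scaled-abs (+ y))) (∣±1⇒∣square-1 (+ y * + n) p∣y∣i∣±1)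
    where
    open ≡-Reasoning
    n = ℤ.∣ i ∣
    cast : ∀ m k → + (1 ℕ.+ m ℕ.* k) ≡ + m * + k + 1ℤ
    cast m k = trans (ℤP.pos-+ 1 (m ℕ.* k)) (trans (ℤP.+-comm 1ℤ (+ (m ℕ.* k))) (cong (_+ 1ℤ) (ℤP.pos-* m k)))
    +1-1 : ∀ m → m + 1ℤ - 1ℤ ≡ m
    +1-1 = solve-∀
    ∃-inverse-up-to-sign : ∃ λ y → + p ∣ + y * + n + 1ℤ ⊎ + p ∣ + y * + n - 1ℤ
    ∃-inverse-up-to-sign with coprime-Bézout (prime-∤⇒coprime pp (p∤i ∘ ∣ᵤ⇒∣))
    ... | Bézout.+- x y 1+yn≡xp = y , inj₁ (divides (+ x) (begin
      + y * + n + 1ℤ        ≡⟨ sym (cast y n) ⟩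
      + (1 ℕ.+ y ℕ.* n)     ≡⟨ cong +_ 1+yn≡xp ⟩
      + (x ℕ.* p)           ≡⟨ ℤP.pos-* x p ⟩
      + x * + p             ∎))
    ... | Bézout.-+ x y 1+xp≡yn = y , inj₂ (divides (+ x) (begin
      + y * + n - 1ℤ        ≡⟨ cong (_- 1ℤ) (sym (ℤP.pos-* y n)) ⟩
      + (y ℕ.* n) - 1ℤ      ≡⟨ cong (λ m → + m - 1ℤ) (sym 1+xp≡yn) ⟩
      + (1 ℕ.+ x ℕ.* p) - 1ℤ ≡⟨ cong (_- 1ℤ) (cast x p) ⟩
      + x * + p + 1ℤ - 1ℤ   ≡⟨ +1-1 (+ x * + p) ⟩
      + x * + p             ∎))
    regroup : ∀ α j → (α * j) * (α * j) ≡ α * α * (j * j)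
    regroup = solve-∀
    square-scaled-abs : ∀ α → (α * i) * (α * i) ≡ (α * + n) * (α * + n)
    square-scaled-abs α = trans (regroup α i) (trans (cong (α * α *_) (square-abs i)) (sym (regroup α (+ n))))

  IsSquareMod : ℕ → ℤ → Set
  IsSquareMod p c = ∃ λ x → + p Unsigned.∣ x * x - c

  ∣x²-cy²⇒∣y : ∀ {p c} → Prime p → ¬ IsSquareMod p c → ∀ {x y} → + p ∣ x * x - c * (y * y) → + p ∣ y
  ∣x²-cy²⇒∣y {p} {c} pp c-nonSquare {x} {y} p∣x²-cy² with + p ∣? y
  ... | yes p∣y = p∣y
  ... | no p∤y =
    let α , p∣[αy]²-1 = ∃-square-inverse pp p∤y in
    contradiction (α * x , ∣⇒∣ᵤ (subst (+ p ∣_) (scale α x y c)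
      (∣m∣n⇒∣m+n (∣n⇒∣m*n (α * α) p∣x²-cy²) (∣n⇒∣m*n c p∣[αy]²-1)))) c-nonSquare
    where
    scale : ∀ α x y c → α * α * (x * x - c * (y * y)) + c * ((α * y) * (α * y) - 1ℤ) ≡ (α * x) * (α * x) - c
    scale = solve-∀

  infinite-descent : ∀ {ℓ} {P : ℤ → Set ℓ} {q} → 1 ℕ.< q →
    (∀ {z} → P z → ∃ λ z′ → z ≡ z′ * + q × P z′) → ∀ {z} → P z → z ≡ 0ℤ
  infinite-descent {P = P} {q} 1<q descend {z} =
    <-rec (λ n → ∀ {z} → ℤ.∣ z ∣ ≡ n → P z → z ≡ 0ℤ) go ℤ.∣ z ∣ refl
    where
    go : ∀ n → (∀ {m} → m ℕ.< n → ∀ {z} → ℤ.∣ z ∣ ≡ m → P z → z ≡ 0ℤ) → ∀ {z} → ℤ.∣ z ∣ ≡ n → P z → z ≡ 0ℤ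
    go _ smaller refl Pz with descend Pz
    ... | z′ , refl , Pz′ with z′ ℤ.≟ 0ℤ
    ...   | yes refl = refl
    ...   | no z′≢0 = contradiction (smaller |z′|<|z′q| refl Pz′) z′≢0
      where
      |z′|<|z′q| : ℤ.∣ z′ ∣ ℕ.< ℤ.∣ z′ * + q ∣
      |z′|<|z′q| = subst (ℤ.∣ z′ ∣ ℕ.<_) (sym (ℤP.abs-* z′ (+ q)))
        (ℕP.m<m*n ℤ.∣ z′ ∣ q {{ℕ.≢-nonZero (z′≢0 ∘ ℤP.∣i∣≡0⇒i≡0)}} 1<q)

  -- For s, c > 0 this says that the ternary form X² + s Y² - c s Z² is anisotropic over ℚ.
  Anisotropic : ℤ → ℤ → Set
  Anisotropic s c = ∀ x y z → x * x + s * (y * y) ≡ c * s * (z * z) → z ≡ 0ℤ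

  prime>1 : ∀ {p} → Prime p → 1 ℕ.< p
  prime>1 {p} pp = ℕ.nonTrivial⇒n>1 p {{prime⇒nonTrivial pp}}

  prime-*-cancelˡ : ∀ {p} → Prime p → ∀ {i j} → + p * i ≡ + p * j → i ≡ j
  prime-*-cancelˡ {p} pp {i} {j} = ℤP.*-cancelˡ-≡ (+ p) i j {{prime⇒nonZero pp}}

  square-mono-∣ : ∀ {k i} → k ∣ i → k * k ∣ i * i
  square-mono-∣ {k} {i} k∣i = ∣-trans (*-monoʳ-∣ k k∣i) (*-monoˡ-∣ i k∣i)

  anisotropic-by-descent : ∀ {q s c} → Prime q →
    (∀ x y z → x * x + s * (y * y) ≡ c * s * (z * z) → + q ∣ x × + q ∣ y × + q ∣ z) → Anisotropic s c
  anisotropic-by-descent {q} {s} {c} qp divisible x y z eq =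
    infinite-descent (prime>1 qp) descend (x , y , eq)
    where
    Solution : ℤ → Set
    Solution z = ∃₂ λ x y → x * x + s * (y * y) ≡ c * s * (z * z)
    scaledˡ : ∀ x y s q → (x * q) * (x * q) + s * ((y * q) * (y * q)) ≡ q * (q * (x * x + s * (y * y)))
    scaledˡ = solve-∀
    scaledʳ : ∀ c s z q → c * s * ((z * q) * (z * q)) ≡ q * (q * (c * s * (z * z)))
    scaledʳ = solve-∀
    divide : ∀ {x y z} → x * x + s * (y * y) ≡ c * s * (z * z) → + q ∣ x × + q ∣ y × + q ∣ z →
      ∃ λ z′ → z ≡ z′ * + q × Solution z′
    divide eq (divides x′ refl , divides y′ refl , divides z′ refl) =
      z′ , refl , x′ , y′ , prime-*-cancelˡ qp (prime-*-cancelˡ qp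
        (trans (sym (scaledˡ x′ y′ s (+ q))) (trans eq (scaledʳ c s z′ (+ q)))))
    descend : ∀ {z} → Solution z → ∃ λ z′ → z ≡ z′ * + q × Solution z′
    descend {z} (x , y , eq) = divide {x} {y} {z} eq (divisible x y z eq)

  anisotropic-unramified : ∀ {q s} → Prime q → ¬ + q ∣ s → ¬ IsSquareMod q (- s) → Anisotropic s (+ q)
  anisotropic-unramified {q} {s} qp q∤s -s-nonSquare = anisotropic-by-descent {s = s} {+ q} qp divisible
    where
    minus-neg : ∀ x y s → x * x - (- s) * (y * y) ≡ x * x + s * (y * y)
    minus-neg = solve-∀
    divisible : ∀ x y z → x * x + s * (y * y) ≡ + q * s * (z * z) → + q ∣ x × + q ∣ y × + q ∣ z
    divisible x y z eq = q∣x , q∣y , q∣z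
      where
      q∣x²+sy² : + q ∣ x * x + s * (y * y)
      q∣x²+sy² = subst (+ q ∣_) (sym eq) (∣m⇒∣m*n (z * z) (∣m⇒∣m*n s ∣-refl))
      q∣y : + q ∣ y
      q∣y = ∣x²-cy²⇒∣y qp -s-nonSquare {x} {y} (subst (+ q ∣_) (sym (minus-neg x y s)) q∣x²+sy²)
      q∣x : + q ∣ x
      q∣x = prime-∣-square qp {x} (∣m+n∣n⇒∣m q∣x²+sy² (∣n⇒∣m*n s (∣m⇒∣m*n y q∣y)))
      q²∣x²+sy² : + q * + q ∣ x * x + s * (y * y)
      q²∣x²+sy² = ∣m∣n⇒∣m+n (square-mono-∣ q∣x) (∣n⇒∣m*n s (square-mono-∣ q∣y))
      q∣s*z² : + q ∣ s * (z * z)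
      q∣s*z² = *-cancelˡ-∣ (+ q) {{prime⇒nonZero qp}}
        (subst (+ q * + q ∣_) (trans eq (ℤP.*-assoc (+ q) s (z * z))) q²∣x²+sy²)
      q∣z : + q ∣ z
      q∣z = prime-∣-square qp {z} (fromInj₂ (⊥-elim ∘ q∤s) (euclidsLemmaℤ qp s (z * z) q∣s*z²))

  anisotropic-ramified : ∀ {p u c} → Prime p → ¬ + p ∣ u → ¬ IsSquareMod p c → Anisotropic (+ p * u) c
  anisotropic-ramified {p} {u} {c} pp p∤u c-nonSquare = anisotropic-by-descent {s = + p * u} {c} pp divisible
    where
    difference : ∀ x y z p u c → x * x + p * u * (y * y) ≡ c * (p * u) * (z * z) →
      p * (u * (c * (z * z) - y * y)) ≡ x * x
    difference x y z p u c eq = begin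
      p * (u * (c * (z * z) - y * y))               ≡⟨ expand p u c z y ⟩
      c * (p * u) * (z * z) - p * u * (y * y)       ≡⟨ cong (_- p * u * (y * y)) (sym eq) ⟩
      x * x + p * u * (y * y) - p * u * (y * y)     ≡⟨ cancel (x * x) (p * u * (y * y)) ⟩
      x * x                                         ∎
      where
      open ≡-Reasoning
      expand : ∀ p u c z y → p * (u * (c * (z * z) - y * y)) ≡ c * (p * u) * (z * z) - p * u * (y * y)
      expand = solve-∀
      cancel : ∀ a b → a + b - b ≡ a
      cancel = solve-∀
    sub-sub : ∀ a b → a - (a - b) ≡ b
    sub-sub = solve-∀
    negate : ∀ c z y → - (c * (z * z) - y * y) ≡ y * y - c * (z * z)
    negate = solve-∀
    divisible : ∀ x y z → x * x + + p * u * (y * y) ≡ c * (+ p * u) * (z * z) → + p ∣ x × + p ∣ y × + p ∣ z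
    divisible x y z eq = p∣x , p∣y , p∣z
      where
      x²≡ = difference x y z (+ p) u c eq
      p∣x : + p ∣ x
      p∣x = prime-∣-square pp {x} (subst (+ p ∣_) x²≡ (∣m⇒∣m*n _ ∣-refl))
      p∣cz²-y² : + p ∣ c * (z * z) - y * y
      p∣cz²-y² = fromInj₂ (⊥-elim ∘ p∤u) (euclidsLemmaℤ pp u (c * (z * z) - y * y)
        (*-cancelˡ-∣ (+ p) {{prime⇒nonZero pp}} (subst (+ p * + p ∣_) (sym x²≡) (square-mono-∣ p∣x))))
      p∣z : + p ∣ z
      p∣z = ∣x²-cy²⇒∣y pp c-nonSquare {y} {z} (subst (+ p ∣_) (negate c z y) (∣m⇒∣-m p∣cz²-y²))
      p∣y : + p ∣ y
      p∣y = prime-∣-square pp {y} (subst (+ p ∣_) (sub-sub (c * (z * z)) (y * y))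
        (∣m∣n⇒∣m-n (∣n⇒∣m*n c (∣m⇒∣m*n z p∣z)) p∣cz²-y²))

  anisotropic-*-square : ∀ {s c} t → t ≢ 0ℤ → Anisotropic s c → Anisotropic (t * t * s) c
  anisotropic-*-square {s} {c} t t≢0 anisotropic x y z eq =
    fromInj₂ (⊥-elim ∘ t≢0) (ℤP.i*j≡0⇒i≡0∨j≡0 t {z} t*z≡0)
    where
    absorbˡ : ∀ x y t s → x * x + s * ((t * y) * (t * y)) ≡ x * x + t * t * s * (y * y)
    absorbˡ = solve-∀
    absorbʳ : ∀ c t s z → c * (t * t * s) * (z * z) ≡ c * s * ((t * z) * (t * z))
    absorbʳ = solve-∀
    t*z≡0 : t * z ≡ 0ℤ
    t*z≡0 = anisotropic x (t * y) (t * z) (trans (absorbˡ x y t s) (trans eq (absorbʳ c t s z)))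

  ∣-square-congruent : ∀ {k} x y c → k ∣ (x - y) * (x + y) → k ∣ x * x - c → k ∣ y * y - c
  ∣-square-congruent {k} x y c k∣x²-y² k∣x²-c = subst (k ∣_) (identity x y c) (∣m∣n⇒∣m-n k∣x²-c k∣x²-y²)
    where
    identity : ∀ x y c → x * x - c - (x - y) * (x + y) ≡ y * y - c
    identity = solve-∀

  ∃-reduced-root : ∀ {p c} .{{_ : ℕ.NonZero p}} → IsSquareMod p c → ∃ λ r → r ℕ.< p × + p ∣ + r * + r - c
  ∃-reduced-root {p} {c} (x , p∣x²-c) = x %ℕ p , n%ℕd<d x p ,
    ∣-square-congruent x (+ (x %ℕ p)) c (∣m⇒∣m*n _ (divides (x /ℕ p) x-r≡)) (∣ᵤ⇒∣ p∣x²-c)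
    where
    cancel : ∀ r m → r + m - r ≡ m
    cancel = solve-∀
    x-r≡ : x - + (x %ℕ p) ≡ (x /ℕ p) * + p
    x-r≡ = trans (cong (_- + (x %ℕ p)) (a≡a%ℕn+[a/ℕn]*n x p)) (cancel (+ (x %ℕ p)) ((x /ℕ p) * + p))

  isSquareMod? : ∀ p .{{_ : ℕ.NonZero p}} c → Dec (IsSquareMod p c)
  isSquareMod? p c = Dec.map′ (λ (r , p∣r²-c) → + toℕ r , p∣r²-c) reduce
    (any? λ (r : Fin p) → p ℕ.∣? ℤ.∣ + toℕ r * + toℕ r - c ∣)
    where
    reduce : IsSquareMod p c → ∃ λ (r : Fin p) → p ℕ.∣ ℤ.∣ + toℕ r * + toℕ r - c ∣
    reduce square = let r , r<p , p∣r²-c = ∃-reduced-root square in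
      fromℕ< r<p , subst (λ r → p ℕ.∣ ℤ.∣ + r * + r - c ∣) (sym (Fin.toℕ-fromℕ< r<p)) (∣⇒∣ᵤ p∣r²-c)

  qnr? : ∀ p .{{_ : ℕ.NonZero p}} a → Dec (QNR p a)
  qnr? p a = Dec.¬? (p ℕ.∣? a) Dec.×-dec Dec.¬? (isSquareMod? p (+ a))

  residue-injective : ∀ {p a b} → + p ∣ + a - + b → a ℕ.< p → b ℕ.< p → a ≡ b
  residue-injective {p} {a} {b} p∣a-b a<p b<p with ℤ.∣ + a - + b ∣ in |a-b|≡
  ... | zero  = ℤP.+-injective (ℤP.i-j≡0⇒i≡j (+ a) (+ b) (ℤP.∣i∣≡0⇒i≡0 |a-b|≡))
  ... | suc d = contradiction (subst (p ℕ.∣_) |a-b|≡ (∣⇒∣ᵤ p∣a-b)) (ℕ.>⇒∤ |a-b|<p)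
    where
    |a-b|<p : suc d ℕ.< p
    |a-b|<p = ℕP.≤-<-trans
      (subst (ℕ._≤ a ℕ.⊔ b) (trans (sym (cong ℤ.∣_∣ (ℤP.[+m]-[+n]≡m⊖n a b))) |a-b|≡) (ℤP.∣m⊝n∣≤m⊔n a b))
      (ℕP.⊔-lub a<p b<p)

  small-root : ∀ {h a} → ¬ suc (h ℕ.+ h) ℕ.∣ a → IsSquareMod (suc (h ℕ.+ h)) (+ a) →
    ∃ λ σ → σ ℕ.< h × + suc (h ℕ.+ h) ∣ + suc σ * + suc σ - + a
  small-root {h} {a} p∤a square with ∃-reduced-root square
  ... | zero , _ , p∣0-a = contradiction (subst (suc (h ℕ.+ h) ℕ.∣_) |0-a|≡a (∣⇒∣ᵤ p∣0-a)) p∤a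
    where
    |0-a|≡a : ℤ.∣ 0ℤ - + a ∣ ≡ a
    |0-a|≡a = trans (cong ℤ.∣_∣ (ℤP.+-identityˡ (- + a))) (ℤP.∣-i∣≡∣i∣ (+ a))
  ... | suc σ , r<p , p∣r²-a with suc σ ℕ.≤? h
  ...   | yes r≤h = σ , r≤h , p∣r²-a
  ...   | no r≰h with suc (h ℕ.+ h) ℕ.∸ suc σ in ρ≡
  ...     | zero  = contradiction ρ≡ (ℕP.m>n⇒m∸n≢0 r<p)
  ...     | suc τ =
    τ , τ<h , ∣-square-congruent (+ suc σ) (+ suc τ) (+ a) (∣n⇒∣m*n (+ suc σ - + suc τ) p∣r+ρ) p∣r²-a
    where
    p = suc (h ℕ.+ h)
    τ<h : τ ℕ.< h
    τ<h = subst (ℕ._≤ h) ρ≡ (ℕP.≤-trans (ℕP.∸-monoʳ-≤ p (ℕP.≰⇒> r≰h)) (ℕP.≤-reflexive (ℕP.m+n∸m≡n (suc h) h)))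
    r+ρ≡p : suc σ ℕ.+ suc τ ≡ p
    r+ρ≡p = trans (cong (suc σ ℕ.+_) (sym ρ≡)) (ℕP.m+[n∸m]≡n (ℕP.<⇒≤ r<p))
    p∣r+ρ : + p ∣ + suc σ + + suc τ
    p∣r+ρ = divides 1ℤ
      (trans (sym (ℤP.pos-+ (suc σ) (suc τ))) (trans (cong +_ r+ρ≡p) (sym (ℤP.*-identityˡ (+ p)))))

  nonzero-residues-not-all-squares : ∀ {p h} → 1 ℕ.≤ h → p ≡ suc (h ℕ.+ h) →
    ¬ (∀ a → 1 ℕ.≤ a → a ℕ.< p → IsSquareMod p (+ a))
  nonzero-residues-not-all-squares {h = h} 1≤h refl all-squares =
    let i , j , i<j , same-root = Fin.pigeonhole (ℕP.m<m+n h 1≤h) root-index in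
    ℕP.<-irrefl (sym (residue-injective (p∣aⱼ-aᵢ i j same-root) (a<p j) (a<p i))) (ℕ.s≤s i<j)
    where
    p = suc (h ℕ.+ h)
    a : Fin (h ℕ.+ h) → ℕ
    a i = suc (toℕ i)
    a<p : ∀ i → a i ℕ.< p
    a<p i = ℕ.s≤s (Fin.toℕ<n i)
    root : ∀ i → ∃ λ σ → σ ℕ.< h × + p ∣ + suc σ * + suc σ - + a i
    root i = small-root (ℕ.>⇒∤ (a<p i)) (all-squares (a i) (ℕ.s≤s ℕ.z≤n) (a<p i))
    root-index : Fin (h ℕ.+ h) → Fin h
    root-index i = fromℕ< (proj₁ (proj₂ (root i)))
    difference : ∀ r aᵢ aⱼ → r - aᵢ - (r - aⱼ) ≡ aⱼ - aᵢ
    difference = solve-∀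
    p∣aⱼ-aᵢ : ∀ i j → root-index i ≡ root-index j → + p ∣ + a j - + a i
    p∣aⱼ-aᵢ i j same-root = subst (+ p ∣_) (difference (+ suc σ * + suc σ) (+ a i) (+ a j))
        (∣m∣n⇒∣m-n (proj₂ (proj₂ (root i)))
        (subst (λ σ → + p ∣ + suc σ * + suc σ - + a j) (sym same-σ) (proj₂ (proj₂ (root j)))))
      where
      σ = proj₁ (root i)
      same-σ : σ ≡ proj₁ (root j)
      same-σ = trans (sym (Fin.toℕ-fromℕ< (proj₁ (proj₂ (root i)))))
                     (trans (cong toℕ same-root) (Fin.toℕ-fromℕ< (proj₁ (proj₂ (root j)))))

  odd-prime : ∀ {p} → Prime p → p ≢ 2 → ∃ λ h → 1 ℕ.≤ h × p ≡ suc (h ℕ.+ h)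
  odd-prime {p} pp p≢2 with p ℕ.% 2 | ℕ.m%n<n p 2 | ℕ.m≡m%n+[m/n]*n p 2
  ... | 0 | _ | p≡[p/2]*2 =
    contradiction (fromInj₂ (λ ()) (prime⇒irreducible pp (ℕ.divides (p ℕ./ 2) p≡[p/2]*2))) (p≢2 ∘ sym)
  ... | 1 | _ | p≡1+[p/2]*2 = h , 1≤h , trans p≡1+[p/2]*2 (cong suc h*2≡h+h)
    where
    h = p ℕ./ 2
    h*2≡h+h : h ℕ.* 2 ≡ h ℕ.+ h
    h*2≡h+h = trans (ℕP.*-comm h 2) (cong (h ℕ.+_) (ℕP.+-identityʳ h))
    1≤h : 1 ℕ.≤ h
    1≤h = ℕP.n≢0⇒n>0 λ h≡0 → ℕP.<⇒≢ (prime>1 pp) (sym (trans p≡1+[p/2]*2 (cong (λ h → suc (h ℕ.* 2)) h≡0)))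
  ... | suc (suc _) | ℕ.s≤s (ℕ.s≤s ()) | _

  QNR⇒2≤ : ∀ {p g} → QNR p g → 2 ℕ.≤ g
  QNR⇒2≤ {p} {0}           (p∤0 , _)         = contradiction (p ℕ.∣0) p∤0
  QNR⇒2≤ {p} {1}           (_ , 1-nonSquare) = contradiction (1ℤ , p ℕ.∣0) 1-nonSquare
  QNR⇒2≤ {p} {suc (suc g)} _                 = ℕ.s≤s (ℕ.s≤s ℕ.z≤n)

  ∃-least-QNR : ∀ {p} → Prime p → p ≢ 2 → ∃ λ g → IsLeastQNR p g
  ∃-least-QNR {p} pp p≢2 =
    let g , ¬¬g-QNR , below-g =
          Fin.¬∀⟶∃¬-smallest p (λ k → ¬ QNR p (toℕ k)) (λ k → Dec.¬? (qnr? p (toℕ k))) some-QNR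
        g-QNR = Dec.decidable-stable (qnr? p (toℕ g)) ¬¬g-QNR
    in toℕ g , ℕP.≤-trans (ℕ.s≤s ℕ.z≤n) (QNR⇒2≤ g-QNR) , g-QNR , λ k _ k<g →
       subst (λ k → ¬ QNR p k) (trans (Fin.toℕ-inject (fromℕ< k<g)) (Fin.toℕ-fromℕ< k<g)) (below-g (fromℕ< k<g))
    where
    instance _ = prime⇒nonZero pp
    some-QNR : ¬ (∀ a → ¬ QNR p (toℕ a))
    some-QNR no-QNR = let _ , 1≤h , p≡2h+1 = odd-prime pp p≢2 in
      nonzero-residues-not-all-squares 1≤h p≡2h+1 all-squares
      where
      all-squares : ∀ a → 1 ℕ.≤ a → a ℕ.< p → IsSquareMod p (+ a)
      all-squares a 1≤a a<p = Dec.decidable-stable (isSquareMod? p (+ a)) λ a-nonSquare →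
        no-QNR (fromℕ< a<p)
          (subst (QNR p) (sym (Fin.toℕ-fromℕ< a<p)) (ℕ.>⇒∤ {{ℕ.>-nonZero 1≤a}} a<p , a-nonSquare))

open import Data.Nat using (ℕ; _≤_)
open import Data.Nat.Primality using (Prime)
open import Data.Integer using (ℤ; +_; _*_)
open import Data.Integer as ℤ using ()
open import Data.Product using (Σ; ∃; _×_)
open import Relation.Binary.PropositionalEquality using (_≡_)
open import Relation.Nullary using (¬_)

open import Data.Nat as ℕ using (zero; suc; z≤n; s≤s)
import Data.Nat.Properties as ℕP
import Data.Nat.Divisibility as ℕ
open import Data.Nat.Primality using (prime[2]; prime?)
open import Data.Integer using (_+_; _-_; -_; 0ℤ)
import Data.Integer.Properties as ℤP
open import Data.Integer.Divisibility.Signed using (_∣?_; ∣⇒∣ᵤ)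
open import Data.Integer.Tactic.RingSolver using (solve-∀)
open import Relation.Binary.PropositionalEquality using (≢-sym)
import Data.Sum as Sum
open import Relation.Nullary.Decidable using (from-yes; from-no)
open Positivity using (det2; adjForm; det3; posDef₂⇒leading-minors-pos; posSemiDef₃⇒posDef₃)
open SquareClasses using (Kernel; one; two; oddPrime; square-class)
open Anisotropy
  using (Anisotropic; square-abs; isSquareMod?; anisotropic-unramified; anisotropic-ramified;
         anisotropic-*-square; ∃-least-QNR; QNR⇒2≤)

AnisotropicAtGamma : ℕ → Set
AnisotropicAtGamma n =
  ∃ λ p → Prime p × (p ≡ 2 ⊎ p ℕ.∣ n) × ∃ λ g → IsGamma p g × 2 ≤ g × Anisotropic (+ n) (+ g)

kernel⇒anisotropicAtGamma : ∀ {s} → Kernel s → AnisotropicAtGamma s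
kernel⇒anisotropicAtGamma one =
  2 , prime[2] , inj₁ refl , 7 , inj₁ (refl , refl) , s≤s (s≤s z≤n) ,
  anisotropic-unramified (from-yes (prime? 7)) (from-no (+ 7 ∣? + 1)) (from-no (isSquareMod? 7 (- + 1)))
kernel⇒anisotropicAtGamma two =
  2 , prime[2] , inj₂ ℕ.∣-refl , 7 , inj₁ (refl , refl) , s≤s (s≤s z≤n) ,
  anisotropic-unramified (from-yes (prime? 7)) (from-no (+ 7 ∣? + 2)) (from-no (isSquareMod? 7 (- + 2)))
kernel⇒anisotropicAtGamma (oddPrime {p} {u} pp p≢2 p∤u) =
  let g , γ = ∃-least-QNR pp p≢2
      g-QNR = proj₁ (proj₂ γ)
  in p , pp , inj₂ (ℕ.m∣m*n u) , g , inj₂ (p≢2 , γ) , QNR⇒2≤ g-QNR ,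
     subst (λ s → Anisotropic s (+ g)) (sym (ℤP.pos-* p u)) (anisotropic-ramified pp (p∤u ∘ ∣⇒∣ᵤ) (proj₂ g-QNR))

anisotropicAtGamma : ∀ n → n ≢ 0 → AnisotropicAtGamma n
anisotropicAtGamma n n≢0 =
  let t , s , n≡t*t*s , κ = square-class n n≢0
      p , pp , p≡2⊎p∣s , g , γ , 2≤g , anisotropic = kernel⇒anisotropicAtGamma κ
  in p , pp , Sum.map₂ (λ p∣s → subst (p ℕ.∣_) (sym n≡t*t*s) (ℕ.∣n⇒∣m*n (t ℕ.* t) p∣s)) p≡2⊎p∣s ,
     g , γ , 2≤g , subst (λ m → Anisotropic m (+ g)) (cast t s n≡t*t*s)
                     (anisotropic-*-square {+ s} {+ g} (+ t) (t≢0 t s n≡t*t*s) anisotropic)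
  where
  cast : ∀ t s → n ≡ t ℕ.* t ℕ.* s → + t * + t * + s ≡ + n
  cast t s n≡t*t*s =
    trans (cong (_* + s) (sym (ℤP.pos-* t t))) (trans (sym (ℤP.pos-* (t ℕ.* t) s)) (cong +_ (sym n≡t*t*s)))
  t≢0 : ∀ t s → n ≡ t ℕ.* t ℕ.* s → + t ≢ 0ℤ
  t≢0 zero s n≡0 _ = n≢0 n≡0

det3≢0 : ∀ {a b c C} → a ≢ 0ℤ → Anisotropic (det2 a b c) C → ∀ s t → det3 a b c s t (C * a) ≢ 0ℤ
det3≢0 {a} {b} {c} {C} a≢0 anisotropic s t det≡0 = a≢0 (anisotropic (a * t - b * s) s a (begin
  (a * t - b * s) * (a * t - b * s) + det2 a b c * (s * s) ≡⟨ completing-the-square a b c s t ⟩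
  a * adjForm a b c s t                                   ≡⟨ cong (a *_) adj≡ ⟩
  a * (C * a * det2 a b c)                                ≡⟨ regroup a C (det2 a b c) ⟩
  C * det2 a b c * (a * a)                                ∎))
  where
  open ≡-Reasoning
  adj≡ : adjForm a b c s t ≡ C * a * det2 a b c
  adj≡ = sym (ℤP.i-j≡0⇒i≡j (C * a * det2 a b c) (adjForm a b c s t) det≡0)
  completing-the-square : ∀ a b c s t →
    (a * t - b * s) * (a * t - b * s) + (a * c - b * b) * (s * s)
    ≡ a * (s * (c * s - b * t) + t * (a * t - b * s))
  completing-the-square = solve-∀
  regroup : ∀ a C d → a * (C * a * d) ≡ C * d * (a * a)
  regroup = solve-∀

0<i⇒∣i∣≢0 : ∀ {i} → 0ℤ ℤ.< i → ℤ.∣ i ∣ ≢ 0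
0<i⇒∣i∣≢0 0<i ∣i∣≡0 = ℤP.<⇒≢ 0<i (sym (ℤP.∣i∣≡0⇒i≡0 ∣i∣≡0))

prime≤a*c : ∀ {a b c p} → 0ℤ ℤ.< a → 0ℤ ℤ.< det2 a b c → ¬ (a ≡ + 1 × b ≡ + 0 × c ≡ + 1) →
  p ≡ 2 ⊎ p ℕ.∣ ℤ.∣ det2 a b c ∣ → + p ℤ.≤ a * c
prime≤a*c {a} {b} {c} {p} 0<a 0<d M≢I p≡2⊎p∣n =
  subst (_ ℤ.≤_) (sym a*c≡n+σ) (ℤ.+≤+ ([ p≡2⇒p≤n+σ , p∣n⇒p≤n+σ ]′ p≡2⊎p∣n))
  where
  n = ℤ.∣ det2 a b c ∣
  σ = ℤ.∣ b ∣ ℕ.* ℤ.∣ b ∣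
  n≢0 = 0<i⇒∣i∣≢0 0<d
  σ≡0⇒b≡0 : σ ≡ 0 → b ≡ + 0
  σ≡0⇒b≡0 σ≡0 = ℤP.∣i∣≡0⇒i≡0 (Sum.reduce (ℕP.m*n≡0⇒m≡0∨n≡0 ℤ.∣ b ∣ σ≡0))
  a*c≡n+σ : a * c ≡ + (n ℕ.+ σ)
  a*c≡n+σ = begin
    a * c                             ≡⟨ split a b c ⟩
    det2 a b c + b * b                ≡⟨ cong₂ _+_ (sym (ℤP.0≤i⇒+∣i∣≡i (ℤP.<⇒≤ 0<d))) (square-abs b) ⟩
    + n + + ℤ.∣ b ∣ * + ℤ.∣ b ∣        ≡⟨ cong (_+_ (+ n)) (sym (ℤP.pos-* ℤ.∣ b ∣ ℤ.∣ b ∣)) ⟩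
    + n + + σ                         ≡⟨ sym (ℤP.pos-+ n σ) ⟩
    + (n ℕ.+ σ)                       ∎
    where
    open ≡-Reasoning
    split : ∀ a b c → a * c ≡ (a * c - b * b) + b * b
    split = solve-∀
  2≤m+τ : ∀ m τ → m ≢ 0 → a * c ≡ + (m ℕ.+ τ) → (τ ≡ 0 → b ≡ + 0) → 2 ≤ m ℕ.+ τ
  2≤m+τ zero          _       m≢0 _     _   = ⊥-elim (m≢0 refl)
  2≤m+τ (suc zero)    zero    _   a*c≡1 b≡0 = ⊥-elim (M≢I (a≡1 , b≡0 refl , c≡1))
    where
    a≡1 : a ≡ + 1
    a≡1 = trans (sym (ℤP.0≤i⇒+∣i∣≡i (ℤP.<⇒≤ 0<a)))
                (cong +_ (ℕP.m*n≡1⇒m≡1 ℤ.∣ a ∣ ℤ.∣ c ∣ (trans (sym (ℤP.abs-* a c)) (cong ℤ.∣_∣ a*c≡1))))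
    c≡1 : c ≡ + 1
    c≡1 = trans (sym (ℤP.*-identityˡ c)) (trans (cong (_* c) (sym a≡1)) a*c≡1)
  2≤m+τ (suc zero)    (suc _) _   _     _   = s≤s (s≤s z≤n)
  2≤m+τ (suc (suc _)) _       _   _     _   = s≤s (s≤s z≤n)
  p≡2⇒p≤n+σ : p ≡ 2 → p ≤ n ℕ.+ σ
  p≡2⇒p≤n+σ p≡2 = subst (_≤ n ℕ.+ σ) (sym p≡2) (2≤m+τ n σ n≢0 a*c≡n+σ σ≡0⇒b≡0)
  p∣n⇒p≤n+σ : p ℕ.∣ n → p ≤ n ℕ.+ σ
  p∣n⇒p≤n+σ p∣n = ℕP.≤-trans (ℕ.∣⇒≤ {{ℕ.≢-nonZero n≢0}} p∣n) (ℕP.m≤m+n n σ)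

corollary4p6 : (m11 m12 m22 : ℤ) →
    PosDef 2 (mat2 m11 m12 m22) →
    ¬ (m11 ≡ + 1 × m12 ≡ + 0 × m22 ≡ + 1) →
    ∃ λ (p : ℕ) → Prime p × (+ p) ℤ.≤ m11 * m22 ×
      ∃ λ (C : ℤ) → + 2 ℤ.≤ C × (∃ λ (g : ℕ) → IsGamma p g × C ℤ.≤ + g) ×
        ((v1 v2 : ℤ) →
          PosSemiDef 3 (mat3 m11 m12 m22 v1 v2 (C * m11)) →
          PosDef 3 (mat3 m11 m12 m22 v1 v2 (C * m11)))
corollary4p6 m11 m12 m22 pd M≢I =
  let 0<m11 , 0<d = posDef₂⇒leading-minors-pos pd
      p , pp , p≡2⊎p∣d , g , γ , 2≤g , anisotropic = anisotropicAtGamma ℤ.∣ det2 m11 m12 m22 ∣ (0<i⇒∣i∣≢0 0<d)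
      d-anisotropic = subst (λ d → Anisotropic d (+ g)) (ℤP.0≤i⇒+∣i∣≡i (ℤP.<⇒≤ 0<d)) anisotropic
  in p , pp , prime≤a*c 0<m11 0<d M≢I p≡2⊎p∣d , + g , ℤ.+≤+ 2≤g , (g , γ , ℤP.≤-refl) ,
     λ v1 v2 → posSemiDef₃⇒posDef₃ 0<m11 0<d
                 (det3≢0 {m11} {m12} {m22} {+ g} (≢-sym (ℤP.<⇒≢ 0<m11)) d-anisotropic v1 v2)
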